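{- Let $P=\{(121,204),(175,196),(216,82),(189,51),(44,96),(36,140),(127,135)\}\subset\mathbb{R}^2$. Then $P$ is in general position and $\mu(D(P))=\binom{7}{2}-9=12$.
   Context: A set of points in the plane is in general position if no three of its points are collinear. For distinct $x,y\in P$, $xy$ denotes the closed straight-line segment with endpoints $x,y$, and $\mathcal{P}$ is the set of all such segments. The disjointness graph of segments $D(P)$ has vertex set $\mathcal{P}$, two segments being adjacent if and only if they are disjoint. For a graph $G$ and $U\subseteq V(G)$, two distinct vertices $x,y\in U$ are $U$-mutually visible if $G$ contains a shortest $x$-$y$ path none of whose internal vertices lies in $U$; $U$ is a mutual-visibility set if every two distinct vertices of $U$ are $U$-mutually visible; $\mu(G)$ is the largest size of a mutual-visibility set of $G$.
   Formalization: The plane is taken as ℚ² instead of ℝ², so the collinearity parameter and the common points deciding disjointness of segments in D(P) are taken in the rationals. -}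

module Defs where

open import Data.Nat as ℕ using (ℕ)
open import Data.Integer using (ℤ; +_)
open import Data.Rational using (ℚ; _/_; _+_; _*_; _-_; _≤_; 0ℚ; 1ℚ)
open import Data.Fin as Fin using (Fin)
open import Data.Product using (_×_; _,_; Σ; ∃; ∃-syntax)
open import Data.List using (List; []; _∷_; length)
open import Data.List.Membership.Propositional using (_∈_; _∉_)
open import Data.List.Relation.Unary.All using (All)
open import Data.List.Relation.Unary.Unique.Propositional using (Unique)
open import Relation.Binary.PropositionalEquality using (_≡_; _≢_)
open import Relation.Nullary using (¬_)

Point : Set
Point = ℚ × ℚ

pt : ℕ → ℕ → Point
pt x y = (+ x / 1 , + y / 1)

affine : Point → Point → ℚ → Point
affine (a₁ , a₂) (b₁ , b₂) t = (a₁ + t * (b₁ - a₁) , a₂ + t * (b₂ - a₂))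

-- Three points are collinear: c lies on the line through a and b (a ≠ b)
Collinear : Point → Point → Point → Set
Collinear a b c = ∃[ t ] (c ≡ affine a b t)

P : Fin 7 → Point
P Fin.zero = pt 121 204
P (Fin.suc Fin.zero) = pt 175 196
P (Fin.suc (Fin.suc Fin.zero)) = pt 216 82
P (Fin.suc (Fin.suc (Fin.suc Fin.zero))) = pt 189 51
P (Fin.suc (Fin.suc (Fin.suc (Fin.suc Fin.zero)))) = pt 44 96
P (Fin.suc (Fin.suc (Fin.suc (Fin.suc (Fin.suc Fin.zero))))) = pt 36 140
P (Fin.suc (Fin.suc (Fin.suc (Fin.suc (Fin.suc (Fin.suc Fin.zero)))))) = pt 127 135

-- The 7 points are pairwise distinct (part of "P is a 7-point set")
-- and no three of them are collinear.
GeneralPosition : (Fin 7 → Point) → Set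
GeneralPosition Q =
  (∀ i j → i ≢ j → Q i ≢ Q j) ×
  (∀ i j k → i ≢ j → i ≢ k → j ≢ k → ¬ Collinear (Q i) (Q j) (Q k))

OnSegment : Point → Point → Point → Set
OnSegment a b x = ∃[ t ] ((0ℚ ≤ t) × (t ≤ 1ℚ) × (x ≡ affine a b t))

SegDisjoint : Point → Point → Point → Point → Set
SegDisjoint a b c d = ¬ (∃[ x ] (OnSegment a b x × OnSegment c d x))

-- Vertices of D(P): the segments xy, x ≠ y, represented canonically
-- by the index pair (i , j) with i < j (so xy = yx is one vertex).
record Seg : Set where
  constructor seg
  field
    i  : Fin 7
    j  : Fin 7
    lt : i Fin.< j
open Seg public

Adj : Seg → Seg → Set
Adj s s' = SegDisjoint (P (i s)) (P (j s)) (P (i s')) (P (j s'))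

-- A walk u, w₁, …, wₖ, v in D(P), given by its list of internal vertices
IsWalk : Seg → List Seg → Seg → Set
IsWalk u [] v = Adj u v
IsWalk u (w ∷ ws) v = Adj u w × IsWalk w ws v

IsShortest : Seg → List Seg → Seg → Set
IsShortest u ws v =
  IsWalk u ws v × (∀ ws' → IsWalk u ws' v → length ws ℕ.≤ length ws')

MutuallyVisible : List Seg → Seg → Seg → Set
MutuallyVisible U x y = ∃[ ws ] (IsShortest x ws y × All (_∉ U) ws)

IsMVSet : List Seg → Set
IsMVSet U = ∀ x y → x ∈ U → y ∈ U → x ≢ y → MutuallyVisible U x y

MuEq : ℕ → Set
MuEq m =
  (∃[ U ] (Unique U × IsMVSet U × length U ≡ m)) ×
  (∀ U → Unique U → IsMVSet U → length U ℕ.≤ m)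

-- A mutual-visibility set U of D(P) never contains a whole blocking set {s, t} ∪ (N(s) ∩ N(t)) of two
-- segments s, t at distance two: a shortest s–t path has a single inner vertex, a common neighbour, and
-- all of these would lie in U. So U, read as a subset of the 21 segments, is an independent set of the
-- hypergraph of blocking sets, and a branch-and-bound certificate shows that such sets have at most 12
-- elements. Conversely, in the 12-element set below every two segments are adjacent or have a common
-- neighbour outside the set. Adjacency in D(P) is decided from the coordinates: two disjoint segments
-- are strictly separated by the line through one of them, and two segments that meet do so at the point
-- found by Cramer's rule.

module Submission where

open import Defs
open import Data.Product using (_×_)
open import Data.Nat using (_∸_)
open import Data.Nat.Combinatorics using (_C_)
open import Relation.Binary.PropositionalEquality using (_≡_)

open import Agda.Builtin.FromNat using (Number)
open import Data.Bool using (Bool; true; false; T; not; _∧_; _∨_)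
open import Data.Bool.Properties using (T?; T-∧)
open import Data.Fin as Fin using (Fin; zero; suc)
open import Data.Fin.Literals using (number)
open import Data.Fin.Properties using (<-irrelevant; all?; injective⇒≤) renaming (_≟_ to _≟ᶠ_)
open import Data.List
  using (List; []; _∷_; length; lookup; filter; map; _++_; allFin; concatMap; cartesianProduct)
open import Data.List.Properties using (length-++; length-map)
open import Data.List.Membership.Propositional using (_∈_; _∉_; find; lose)
open import Data.List.Membership.Propositional.Properties
  using (∈-lookup; ∈-allFin; ∈-filter⁺; ∈-filter⁻; ∈-++⁻; ∈-concatMap⁺; ∈-cartesianProduct⁺)
open import Data.List.Relation.Binary.Disjoint.Propositional using (Disjoint)
open import Data.List.Relation.Binary.Subset.Propositional using (_⊆_)
open import Data.List.Relation.Unary.All as All using (All; []; _∷_; Null) renaming (all? to all?ₗ)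
open import Data.List.Relation.Unary.All.Properties using (¬All⇒Any¬)
open import Data.List.Relation.Unary.AllPairs using (AllPairs; []; _∷_; allPairs?)
open import Data.List.Relation.Unary.Any as Any using (Any; here; there; any?; satisfied)
open import Data.List.Relation.Unary.Any.Properties using (lookup-index)
open import Data.List.Relation.Unary.Unique.Propositional using (Unique)
import Data.List.Relation.Unary.Unique.Propositional.Properties as Unique
open import Data.Product using (Σ-syntax; _,_; proj₁; proj₂; uncurry)
open import Data.Product.Properties using (×-≡,≡→≡; ×-≡,≡←≡)
open import Data.Sum using (_⊎_; inj₁; inj₂)
open import Data.Unit using (tt)
open import Function using (_∘_; Equivalence)
open import Relation.Binary.Definitions using (DecidableEquality)
open import Relation.Binary.PropositionalEquality using (_≢_; refl; sym; trans; cong; subst; module ≡-Reasoning)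
open import Relation.Nullary using (¬_; Dec; yes; no; contradiction)
open import Relation.Nullary.Decidable
  using (_×-dec_; _⊎-dec_; _→-dec_; ¬?; map′; isYes; True; toWitness; fromWitness; from-yes)
open import Relation.Unary using (Decidable)
open import Relation.Unary.Properties using (∅?)

module Geometry where

  open import Data.Rational
    using (ℚ; _+_; _*_; _-_; -_; _≤_; _<_; _⊓_; 0ℚ; 1ℚ; _÷_; ≢-nonZero; nonNegative)
  open import Data.Rational.Properties
    using (_≟_; _≤?_; _<?_; ≤-trans; +-mono-≤; +-monoˡ-≤; +-inverseʳ; *-monoˡ-≤-nonNeg; neg-antimono-≤;
           <-≤-trans; <-irrefl; p⊓q≤p; p⊓q≤q; ⊓-sel; module ≤-Reasoning)
  open import Data.Rational.Solver using (module +-*-Solver)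

  LinearForm : Set
  LinearForm = ℚ × ℚ × ℚ

  infix 9 _⟨_⟩

  _⟨_⟩ : LinearForm → Point → ℚ
  (α , β , γ) ⟨ x , y ⟩ = α * x + β * y + γ

  lineThrough : Point → Point → LinearForm
  lineThrough (a₁ , a₂) (b₁ , b₂) = (b₂ - a₂ , a₁ - b₁ , b₁ * a₂ - a₁ * b₂)

  ⟨affine⟩ : ∀ f a b t → f ⟨ affine a b t ⟩ ≡ f ⟨ a ⟩ + t * (f ⟨ b ⟩ - f ⟨ a ⟩)
  ⟨affine⟩ (α , β , γ) (a₁ , a₂) (b₁ , b₂) t =
    solve 8 (λ α β γ a₁ a₂ b₁ b₂ t →
      α :* (a₁ :+ t :* (b₁ :- a₁)) :+ β :* (a₂ :+ t :* (b₂ :- a₂)) :+ γ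
      := (α :* a₁ :+ β :* a₂ :+ γ) :+ t :* ((α :* b₁ :+ β :* b₂ :+ γ) :- (α :* a₁ :+ β :* a₂ :+ γ)))
      refl α β γ a₁ a₂ b₁ b₂ t
    where open +-*-Solver

  lineThrough-vanishes : ∀ a b t → lineThrough a b ⟨ affine a b t ⟩ ≡ 0ℚ
  lineThrough-vanishes (a₁ , a₂) (b₁ , b₂) t =
    solve 5 (λ a₁ a₂ b₁ b₂ t →
      (b₂ :- a₂) :* (a₁ :+ t :* (b₁ :- a₁)) :+ (a₁ :- b₁) :* (a₂ :+ t :* (b₂ :- a₂)) :+ (b₁ :* a₂ :- a₁ :* b₂)
      := con 0ℚ)
      refl a₁ a₂ b₁ b₂ t
    where open +-*-Solver

  OffLine : Point → Point → Point → Set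
  OffLine a b c = lineThrough a b ⟨ c ⟩ ≢ 0ℚ

  offLine? : ∀ a b c → Dec (OffLine a b c)
  offLine? a b c = ¬? (lineThrough a b ⟨ c ⟩ ≟ 0ℚ)

  offLine⇒¬collinear : ∀ {a b c} → OffLine a b c → ¬ Collinear a b c
  offLine⇒¬collinear {a} {b} off (t , refl) = off (lineThrough-vanishes a b t)

  interpolation-≤ : ∀ {t u v m} → 0ℚ ≤ t → t ≤ 1ℚ → u ≤ m → v ≤ m → u + t * (v - u) ≤ m
  interpolation-≤ {t} {u} {v} {m} 0≤t t≤1 u≤m v≤m = begin
    u + t * (v - u)       ≡⟨ solve 3 (λ t u v → u :+ t :* (v :- u) := (con 1ℚ :- t) :* u :+ t :* v) refl t u v ⟩
    (1ℚ - t) * u + t * v  ≤⟨ +-mono-≤ (*-monoˡ-≤-nonNeg (1ℚ - t) {{nonNegative 0≤1-t}} u≤m)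
                                      (*-monoˡ-≤-nonNeg t {{nonNegative 0≤t}} v≤m) ⟩
    (1ℚ - t) * m + t * m  ≡⟨ solve 2 (λ t m → (con 1ℚ :- t) :* m :+ t :* m := m) refl t m ⟩
    m                     ∎
    where
    open +-*-Solver
    open ≤-Reasoning
    0≤1-t : 0ℚ ≤ 1ℚ - t
    0≤1-t = subst (_≤ 1ℚ - t) (+-inverseʳ t) (+-monoˡ-≤ (- t) t≤1)

  interpolation-≥ : ∀ {t u v m} → 0ℚ ≤ t → t ≤ 1ℚ → m ≤ u → m ≤ v → m ≤ u + t * (v - u)
  interpolation-≥ {t} {u} {v} {m} 0≤t t≤1 m≤u m≤v = begin
    m                          ≡⟨ solve 1 (λ m → m := :- (:- m)) refl m ⟩
    - (- m)                    ≤⟨ neg-antimono-≤ negated ⟩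
    - (- u + t * (- v - - u))  ≡⟨ solve 3 (λ t u v → :- (:- u :+ t :* (:- v :- :- u)) := u :+ t :* (v :- u))
                                         refl t u v ⟩
    u + t * (v - u)            ∎
    where
    open +-*-Solver
    open ≤-Reasoning
    negated : - u + t * (- v - - u) ≤ - m
    negated = interpolation-≤ 0≤t t≤1 (neg-antimono-≤ m≤u) (neg-antimono-≤ m≤v)

  onSegment-≤ : ∀ f {a b x m} → f ⟨ a ⟩ ≤ m → f ⟨ b ⟩ ≤ m → OnSegment a b x → f ⟨ x ⟩ ≤ m
  onSegment-≤ f {a} {b} fa≤m fb≤m (t , 0≤t , t≤1 , refl) =
    subst (_≤ _) (sym (⟨affine⟩ f a b t)) (interpolation-≤ 0≤t t≤1 fa≤m fb≤m)

  onSegment-≥ : ∀ f {a b x m} → m ≤ f ⟨ a ⟩ → m ≤ f ⟨ b ⟩ → OnSegment a b x → m ≤ f ⟨ x ⟩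
  onSegment-≥ f {a} {b} m≤fa m≤fb (t , 0≤t , t≤1 , refl) =
    subst (_ ≤_) (sym (⟨affine⟩ f a b t)) (interpolation-≥ 0≤t t≤1 m≤fa m≤fb)

  SeparatedBy : LinearForm → Point → Point → Point → Point → Set
  SeparatedBy f a b c d = (f ⟨ a ⟩ ≤ 0ℚ × f ⟨ b ⟩ ≤ 0ℚ) × (0ℚ < f ⟨ c ⟩ × 0ℚ < f ⟨ d ⟩)

  separatedBy? : ∀ f a b c d → Dec (SeparatedBy f a b c d)
  separatedBy? f a b c d = ((f ⟨ a ⟩ ≤? 0ℚ) ×-dec (f ⟨ b ⟩ ≤? 0ℚ)) ×-dec ((0ℚ <? f ⟨ c ⟩) ×-dec (0ℚ <? f ⟨ d ⟩))

  separatedBy⇒disjoint : ∀ f {a b c d} → SeparatedBy f a b c d → SegDisjoint a b c d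
  separatedBy⇒disjoint f {c = c} {d} ((fa≤0 , fb≤0) , (0<fc , 0<fd)) (x , x∈ab , x∈cd) =
    <-irrefl refl (<-≤-trans 0<min (≤-trans min≤fx (onSegment-≤ f fa≤0 fb≤0 x∈ab)))
    where
    min≤fx : f ⟨ c ⟩ ⊓ f ⟨ d ⟩ ≤ f ⟨ x ⟩
    min≤fx = onSegment-≥ f (p⊓q≤p (f ⟨ c ⟩) (f ⟨ d ⟩)) (p⊓q≤q (f ⟨ c ⟩) (f ⟨ d ⟩)) x∈cd
    0<min : 0ℚ < f ⟨ c ⟩ ⊓ f ⟨ d ⟩
    0<min with ⊓-sel (f ⟨ c ⟩) (f ⟨ d ⟩)
    ... | inj₁ min≡fc = subst (0ℚ <_) (sym min≡fc) 0<fc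
    ... | inj₂ min≡fd = subst (0ℚ <_) (sym min≡fd) 0<fd

  disjoint-sym : ∀ {a b c d} → SegDisjoint a b c d → SegDisjoint c d a b
  disjoint-sym disjoint (x , x∈cd , x∈ab) = disjoint (x , x∈ab , x∈cd)

  Separated : Point → Point → Point → Point → Set
  Separated a b c d = Any (λ f → SeparatedBy f a b c d ⊎ SeparatedBy f c d a b)
    (lineThrough a b ∷ lineThrough b a ∷ lineThrough c d ∷ lineThrough d c ∷ [])

  separated? : ∀ a b c d → Dec (Separated a b c d)
  separated? a b c d = any? (λ f → separatedBy? f a b c d ⊎-dec separatedBy? f c d a b) _

  separated⇒disjoint : ∀ {a b c d} → Separated a b c d → SegDisjoint a b c d
  separated⇒disjoint {a} {b} {c} {d} separated with satisfied separated
  ... | f , inj₁ abcd = separatedBy⇒disjoint f abcd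
  ... | f , inj₂ cdab = disjoint-sym {c} {d} {a} {b} (separatedBy⇒disjoint f cdab)

  MeetAt : Point → Point → Point → Point → ℚ × ℚ → Set
  MeetAt a b c d (t , s) = (0ℚ ≤ t × t ≤ 1ℚ) × (0ℚ ≤ s × s ≤ 1ℚ) × affine a b t ≡ affine c d s

  meetAt⇒¬disjoint : ∀ {a b c d} ts → MeetAt a b c d ts → ¬ SegDisjoint a b c d
  meetAt⇒¬disjoint {a} {b} (t , s) ((0≤t , t≤1) , (0≤s , s≤1) , meet) disjoint =
    disjoint (affine a b t , (t , 0≤t , t≤1 , refl) , (s , 0≤s , s≤1 , meet))

  -- Unlike Data.Product.Properties.≡-dec, this does not match on the equality proof of the first
  -- components, which would make deciding equality of concrete rational points very slow.
  _≟ᵖ_ : DecidableEquality Point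
  (x₁ , x₂) ≟ᵖ (y₁ , y₂) = map′ ×-≡,≡→≡ ×-≡,≡←≡ ((x₁ ≟ y₁) ×-dec (x₂ ≟ y₂))

  meetAt? : ∀ a b c d ts → Dec (MeetAt a b c d ts)
  meetAt? a b c d (t , s) =
    ((0ℚ ≤? t) ×-dec (t ≤? 1ℚ)) ×-dec ((0ℚ ≤? s) ×-dec (s ≤? 1ℚ)) ×-dec (affine a b t ≟ᵖ affine c d s)

  _⊖_ : Point → Point → Point
  (x₁ , x₂) ⊖ (y₁ , y₂) = (x₁ - y₁ , x₂ - y₂)

  det : Point → Point → ℚ
  det (x₁ , x₂) (y₁ , y₂) = x₁ * y₂ - x₂ * y₁

  -- Cramer's rule for a + t (b - a) = c + s (d - c). The result is only a candidate, so the junk value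
  -- returned for parallel lines is harmless.
  crossingParameters : Point → Point → Point → Point → ℚ × ℚ
  crossingParameters a b c d with det (b ⊖ a) (d ⊖ c) ≟ 0ℚ
  ... | yes _  = (0ℚ , 0ℚ)
  ... | no Δ≢0 = (det (c ⊖ a) (d ⊖ c) ÷ Δ , det (c ⊖ a) (b ⊖ a) ÷ Δ)
    where
    Δ = det (b ⊖ a) (d ⊖ c)
    instance _ = ≢-nonZero Δ≢0

  Crossing : Point → Point → Point → Point → Set
  Crossing a b c d = MeetAt a b c d (crossingParameters a b c d)

  crossing? : ∀ a b c d → Dec (Crossing a b c d)
  crossing? a b c d = meetAt? a b c d (crossingParameters a b c d)

open Geometry

open import Data.Nat as ℕ using (ℕ; z≤n; s≤s; _≤_; _+_; _≤?_)
import Data.Nat.Properties as ℕ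

adjacent⇒mutuallyVisible : ∀ {U x y} → Adj x y → MutuallyVisible U x y
adjacent⇒mutuallyVisible x~y = [] , (x~y , λ _ _ → z≤n) , []

commonNeighbour⇒mutuallyVisible : ∀ {U x y w} → ¬ Adj x y → Adj x w → Adj w y → w ∉ U →
                                  MutuallyVisible U x y
commonNeighbour⇒mutuallyVisible {x = x} {y} {w} x≁y x~w w~y w∉U =
  w ∷ [] , ((x~w , w~y) , shortest) , w∉U ∷ []
  where
  shortest : ∀ ws → IsWalk x ws y → 1 ≤ length ws
  shortest []      x~y = contradiction x~y x≁y
  shortest (_ ∷ _) _   = s≤s z≤n

commonNeighbours⊆⇒¬mutuallyVisible : ∀ {U x y w₀} → ¬ Adj x y → Adj x w₀ → Adj w₀ y →
                                     (∀ {w} → Adj x w → Adj w y → w ∈ U) → ¬ MutuallyVisible U x y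
commonNeighbours⊆⇒¬mutuallyVisible x≁y _ _ _ ([] , (x~y , _) , _) = x≁y x~y
commonNeighbours⊆⇒¬mutuallyVisible _ _ _ ⊆U (w ∷ [] , ((x~w , w~y) , _) , w∉U ∷ []) = w∉U (⊆U x~w w~y)
commonNeighbours⊆⇒¬mutuallyVisible {w₀ = w₀} _ x~w₀ w₀~y _ (_ ∷ _ ∷ _ , (_ , shortest) , _)
  with s≤s () ← shortest (w₀ ∷ []) (x~w₀ , w₀~y)

lookup-injective : ∀ {A : Set} {xs : List A} → Unique xs → ∀ {i j} → lookup xs i ≡ lookup xs j → i ≡ j
lookup-injective (_ ∷ _)    {zero}  {zero}  _  = refl
lookup-injective (x∉xs ∷ _) {zero}  {suc j} eq = contradiction eq (All.lookup x∉xs (∈-lookup j))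
lookup-injective (x∉xs ∷ _) {suc i} {zero}  eq = contradiction (sym eq) (All.lookup x∉xs (∈-lookup i))
lookup-injective (_ ∷ uniq) {suc i} {suc j} eq = cong suc (lookup-injective uniq eq)

unique-⊆⇒length≤ : ∀ {A : Set} {xs ys : List A} → Unique xs → xs ⊆ ys → length xs ≤ length ys
unique-⊆⇒length≤ {xs = xs} {ys} uniq xs⊆ys = injective⇒≤ position-injective
  where
  position : Fin (length xs) → Fin (length ys)
  position i = Any.index (xs⊆ys (∈-lookup i))
  lookup-position : ∀ i → lookup xs i ≡ lookup ys (position i)
  lookup-position i = lookup-index (xs⊆ys (∈-lookup i))
  position-injective : ∀ {i j} → position i ≡ position j → i ≡ j
  position-injective {i} {j} eq = lookup-injective uniq (begin
    lookup xs i             ≡⟨ lookup-position i ⟩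
    lookup ys (position i)  ≡⟨ cong (lookup ys) eq ⟩
    lookup ys (position j)  ≡⟨ lookup-position j ⟨
    lookup xs j             ∎)
    where open ≡-Reasoning

representatives : ∀ {A : Set} {P : A → Set} (Bs : List (List A)) → AllPairs Disjoint Bs → All (Any P) Bs →
                  Σ[ ks ∈ List A ] length ks ≡ length Bs × Unique ks × All P ks
representatives {P = P} Bs disjoint PBs =
  let ks , len , uniq , Pks , _ = pick Bs disjoint PBs in ks , len , uniq , Pks
  where
  pick : ∀ Bs → AllPairs Disjoint Bs → All (Any P) Bs →
         Σ[ ks ∈ List _ ] length ks ≡ length Bs × Unique ks × All P ks × All (λ k → Any (k ∈_) Bs) ks
  pick [] [] [] = [] , refl , [] , [] , []
  pick (B ∷ Bs) (B#Bs ∷ disjoint) (PB ∷ PBs)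
    with ks , len , uniq , Pks , ks∈Bs ← pick Bs disjoint PBs
       | k , k∈B , Pk ← find PB
    = k ∷ ks , cong ℕ.suc len , All.tabulate k≢ ∷ uniq , Pk ∷ Pks , here k∈B ∷ All.map there ks∈Bs
    where
    k≢ : ∀ {k′} → k′ ∈ ks → k ≢ k′
    k≢ k′∈ks refl with B′ , B′∈Bs , k∈B′ ← find (All.lookup ks∈Bs k′∈ks) =
      All.lookup B#Bs B′∈Bs (k∈B , k∈B′)

-- Branch-and-bound certificates bounding the independent sets (sets containing no edge) of a hypergraph
-- on a finite type. A node is read under a partial decision: the vertices in I are in the set, those in
-- X are not. A packing leaf lists edges avoiding X whose undecided parts are pairwise disjoint: each of
-- them omits one of its undecided vertices, so the set misses at least that many vertices outside X.
module Independence {A Edge : Set} (_≟_ : DecidableEquality A)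
                    (elements : List A) (elements-unique : Unique elements)
                    (elements-complete : ∀ a → a ∈ elements)
                    (IsEdge : Edge → Set) (isEdge? : Decidable IsEdge) (members : Edge → List A) where

  open import Data.List.Membership.DecPropositional _≟_ using (_∈?_; _∉?_)
  open import Data.List.Relation.Binary.Disjoint.DecPropositional _≟_ using (disjoint?)

  Selection : Set
  Selection = A → Bool

  size : Selection → ℕ
  size p = length (filter (T? ∘ p) elements)

  Independent : Selection → Set
  Independent p = ∀ e → IsEdge e → ¬ All (T ∘ p) (members e)

  Refines : Selection → List A → List A → Set
  Refines p I X = All (T ∘ p) I × All (¬_ ∘ T ∘ p) X

  undecided : List A → Edge → List A
  undecided I e = filter (_∉? I) (members e)

  possible : List A → ℕ
  possible X = length (filter (_∉? X) elements)

  data Certificate : Set where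
    conflict : Edge → Certificate
    packing  : List Edge → Certificate
    branch   : A → Certificate → Certificate → Certificate

  Valid : ℕ → List A → List A → Certificate → Set
  Valid m I X (conflict e)    = IsEdge e × All (_∈ I) (members e)
  Valid m I X (packing es)    = All IsEdge es × All (λ e → Disjoint (members e) X) es
                              × AllPairs Disjoint (map (undecided I) es) × possible X ≤ m + length es
  Valid m I X (branch k c c′) = Valid m (k ∷ I) X c × Valid m I (k ∷ X) c′

  valid? : ∀ m I X c → Dec (Valid m I X c)
  valid? m I X (conflict e)    = isEdge? e ×-dec all?ₗ (_∈? I) (members e)
  valid? m I X (packing es)    = all?ₗ isEdge? es ×-dec all?ₗ (λ e → disjoint? (members e) X) es
                              ×-dec allPairs? disjoint? (map (undecided I) es) ×-dec possible X ≤? m + length es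
  valid? m I X (branch k c c′) = valid? m (k ∷ I) X c ×-dec valid? m I (k ∷ X) c′

  Omitted : Selection → List A → A → Set
  Omitted p X k = k ∉ X × ¬ T (p k)

  module _ {p : Selection} where

    size+omitted≤possible : ∀ {X ks} → All (¬_ ∘ T ∘ p) X → Unique ks → All (Omitted p X) ks →
                            size p + length ks ≤ possible X
    size+omitted≤possible {X} {ks} X∌p uniq omitted = begin
      size p + length ks       ≡⟨ length-++ selected ⟨
      length (selected ++ ks)  ≤⟨ unique-⊆⇒length≤ unique ⊆possible ⟩
      possible X               ∎
      where
      open ℕ.≤-Reasoning
      selected = filter (T? ∘ p) elements
      selected⇒p : ∀ {k} → k ∈ selected → T (p k)
      selected⇒p k∈ = proj₂ (∈-filter⁻ (T? ∘ p) {xs = elements} k∈)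
      unique : Unique (selected ++ ks)
      unique = Unique.++⁺ (Unique.filter⁺ (T? ∘ p) elements-unique) uniq λ (k∈sel , k∈ks) →
        proj₂ (All.lookup omitted k∈ks) (selected⇒p k∈sel)
      ⊆possible : selected ++ ks ⊆ filter (_∉? X) elements
      ⊆possible {k} k∈ with ∈-++⁻ selected k∈
      ... | inj₁ k∈sel = ∈-filter⁺ (_∉? X) (elements-complete k) λ k∈X →
                           All.lookup X∌p k∈X (selected⇒p k∈sel)
      ... | inj₂ k∈ks  = ∈-filter⁺ (_∉? X) (elements-complete k) (proj₁ (All.lookup omitted k∈ks))

  module _ {p : Selection} (independent : Independent p) where

    omits-undecided : ∀ {I X} es → Refines p I X → All IsEdge es → All (λ e → Disjoint (members e) X) es →
                      All (Any (Omitted p X)) (map (undecided I) es)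
    omits-undecided [] _ [] [] = []
    omits-undecided {I} {X} (e ∷ es) refines@(I⊆p , _) (edge ∷ edges) (e#X ∷ disjointFromX)
      with k , k∈e , ¬pk ← find (¬All⇒Any¬ (T? ∘ p) (members e) (independent e edge)) =
      lose (∈-filter⁺ (_∉? I) k∈e λ k∈I → ¬pk (All.lookup I⊆p k∈I)) ((λ k∈X → e#X (k∈e , k∈X)) , ¬pk)
      ∷ omits-undecided es refines edges disjointFromX

    valid⇒size≤ : ∀ {m I X} c → Valid m I X c → Refines p I X → size p ≤ m
    valid⇒size≤ (conflict e) (edge , e⊆I) (I⊆p , _) =
      contradiction (All.map (All.lookup I⊆p) e⊆I) (independent e edge)
    valid⇒size≤ {m} {I} {X} (packing es) (edges , disjointFromX , packed , bound) refines
      with ks , len , uniq , omitted ← representatives (map (undecided I) es) packed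
                                         (omits-undecided es refines edges disjointFromX) =
      ℕ.+-cancelʳ-≤ (length es) (size p) m (begin
        size p + length es  ≡⟨ cong (size p +_) (trans len (length-map (undecided I) es)) ⟨
        size p + length ks  ≤⟨ size+omitted≤possible (proj₂ refines) uniq omitted ⟩
        possible X          ≤⟨ bound ⟩
        m + length es       ∎)
      where open ℕ.≤-Reasoning
    valid⇒size≤ (branch k c c′) (valid , valid′) (I⊆p , X∌p) with T? (p k)
    ... | yes pk = valid⇒size≤ c valid (pk ∷ I⊆p , X∌p)
    ... | no ¬pk = valid⇒size≤ c′ valid′ (I⊆p , ¬pk ∷ X∌p)

_≟ₛ_ : DecidableEquality Seg
seg i j i<j ≟ₛ seg i′ j′ i′<j′ =
  map′ (λ { (refl , refl) → cong (seg i j) (<-irrelevant i<j i′<j′) }) (λ eq → cong Seg.i eq , cong Seg.j eq)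
       (i ≟ᶠ i′ ×-dec j ≟ᶠ j′)

open import Data.List.Membership.DecPropositional _≟ₛ_ using () renaming (_∈?_ to _∈ₛ?_)
open import Data.List.Relation.Unary.Unique.DecPropositional _≟ₛ_ using (unique?)

infix 6 _─_

_─_ : (i j : Fin 7) → {{True (i Fin.<? j)}} → Seg
(i ─ j) {{i<j}} = seg i j (toWitness i<j)

segmentIfOrdered : Fin 7 → Fin 7 → List Seg
segmentIfOrdered i j with i Fin.<? j
... | yes i<j = seg i j i<j ∷ []
... | no _    = []

segments : List Seg
segments = concatMap (uncurry segmentIfOrdered) (cartesianProduct (allFin 7) (allFin 7))

segments-complete : ∀ s → s ∈ segments
segments-complete (seg i j i<j) =
  ∈-concatMap⁺ (uncurry segmentIfOrdered)
    (Any.map (λ { refl → listed }) (∈-cartesianProduct⁺ (∈-allFin i) (∈-allFin j)))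
  where
  listed : seg i j i<j ∈ segmentIfOrdered i j
  listed with i Fin.<? j
  ... | yes i<j′ = here (cong (seg i j) (<-irrelevant i<j i<j′))
  ... | no  i≮j  = contradiction i<j i≮j

segments-unique : Unique segments
segments-unique = from-yes (unique? segments)

start end : Seg → Point
start s = P (i s)
end   s = P (j s)

instance
  fin7-literals : Number (Fin 7)
  fin7-literals = number 7

-- In this block numerals denote points of P, so that i ─ j is the segment between P i and P j.
module _ where
  open import Agda.Builtin.FromNat using (fromNat)

  crossings : List (Seg × Seg)
  crossings =
    (0 ─ 2 , 1 ─ 3) ∷ (0 ─ 2 , 1 ─ 4) ∷ (0 ─ 2 , 1 ─ 5) ∷ (0 ─ 2 , 1 ─ 6) ∷ (0 ─ 3 , 1 ─ 4) ∷
    (0 ─ 3 , 1 ─ 5) ∷ (0 ─ 3 , 1 ─ 6) ∷ (0 ─ 3 , 2 ─ 4) ∷ (0 ─ 3 , 2 ─ 5) ∷ (0 ─ 3 , 2 ─ 6) ∷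
    (0 ─ 4 , 1 ─ 5) ∷ (0 ─ 4 , 2 ─ 5) ∷ (0 ─ 4 , 3 ─ 5) ∷ (0 ─ 4 , 5 ─ 6) ∷ (0 ─ 6 , 1 ─ 4) ∷
    (0 ─ 6 , 1 ─ 5) ∷ (1 ─ 3 , 2 ─ 4) ∷ (1 ─ 3 , 2 ─ 5) ∷ (1 ─ 3 , 2 ─ 6) ∷ (1 ─ 4 , 2 ─ 5) ∷
    (1 ─ 4 , 3 ─ 5) ∷ (1 ─ 4 , 5 ─ 6) ∷ (2 ─ 4 , 3 ─ 5) ∷ (2 ─ 4 , 3 ─ 6) ∷ (2 ─ 5 , 3 ─ 6) ∷
    (2 ─ 5 , 4 ─ 6) ∷ (3 ─ 5 , 4 ─ 6) ∷ []

shareEndpoint : Seg → Seg → Bool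
shareEndpoint s t = isYes (i s ≟ᶠ i t) ∨ isYes (i s ≟ᶠ j t) ∨ isYes (j s ≟ᶠ i t) ∨ isYes (j s ≟ᶠ j t)

crosses : Seg → Seg → Bool
crosses s t = isYes (any? ((s , t) ≟ₚ_) crossings) ∨ isYes (any? ((t , s) ≟ₚ_) crossings)
  where
  _≟ₚ_ : DecidableEquality (Seg × Seg)
  (s , t) ≟ₚ (s′ , t′) = map′ ×-≡,≡→≡ ×-≡,≡←≡ ((s ≟ₛ s′) ×-dec (t ≟ₛ t′))

adjacent : Seg → Seg → Bool
adjacent s t = not (shareEndpoint s t ∨ crosses s t)

AdjacencyEvidence : Bool → Seg → Seg → Set
AdjacencyEvidence true  s t = Separated (start s) (end s) (start t) (end t)
AdjacencyEvidence false s t = Crossing (start s) (end s) (start t) (end t)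

adjacencyEvidence? : ∀ b s t → Dec (AdjacencyEvidence b s t)
adjacencyEvidence? true  s t = separated? (start s) (end s) (start t) (end t)
adjacencyEvidence? false s t = crossing? (start s) (end s) (start t) (end t)

adjacencyEvidence : ∀ s t → AdjacencyEvidence (adjacent s t) s t
adjacencyEvidence s t = All.lookup (All.lookup checked (segments-complete s)) (segments-complete t)
  where
  checked : All (λ s → All (λ t → AdjacencyEvidence (adjacent s t) s t) segments) segments
  checked = from-yes (all?ₗ (λ s → all?ₗ (λ t → adjacencyEvidence? (adjacent s t) s t) segments) segments)

adjacent⇒Adj : ∀ s t → T (adjacent s t) → Adj s t
adjacent⇒Adj s t = sound (adjacent s t) (adjacencyEvidence s t)
  where
  sound : ∀ b → AdjacencyEvidence b s t → T b → Adj s t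
  sound true separated _ = separated⇒disjoint separated

Adj⇒adjacent : ∀ s t → Adj s t → T (adjacent s t)
Adj⇒adjacent s t disjoint = complete (adjacent s t) (adjacencyEvidence s t)
  where
  complete : ∀ b → AdjacencyEvidence b s t → T b
  complete true  _        = tt
  complete false crossing =
    contradiction disjoint (meetAt⇒¬disjoint {start s} {end s} {start t} {end t} _ crossing)

commonNeighbours : Seg → Seg → List Seg
commonNeighbours s t = filter (λ w → T? (adjacent s w ∧ adjacent w t)) segments

∈-commonNeighbours⁻ : ∀ {s t w} → w ∈ commonNeighbours s t → Adj s w × Adj w t
∈-commonNeighbours⁻ {s} {t} {w} w∈ =
  let s~w , w~t = Equivalence.to (T-∧ {adjacent s w} {adjacent w t})
                    (proj₂ (∈-filter⁻ (λ w → T? (adjacent s w ∧ adjacent w t)) {xs = segments} w∈))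
  in adjacent⇒Adj s w s~w , adjacent⇒Adj w t w~t

∈-commonNeighbours⁺ : ∀ {s t w} → Adj s w → Adj w t → w ∈ commonNeighbours s t
∈-commonNeighbours⁺ {s} {t} {w} s~w w~t =
  ∈-filter⁺ (λ w → T? (adjacent s w ∧ adjacent w t)) (segments-complete w)
    (Equivalence.from (T-∧ {adjacent s w} {adjacent w t}) (Adj⇒adjacent s w s~w , Adj⇒adjacent w t w~t))

blockingSet : Seg × Seg → List Seg
blockingSet (s , t) = s ∷ t ∷ commonNeighbours s t

AtDistanceTwo : Seg × Seg → Set
AtDistanceTwo (s , t) = s ≢ t × ¬ T (adjacent s t) × ¬ Null (commonNeighbours s t)

atDistanceTwo? : ∀ e → Dec (AtDistanceTwo e)
atDistanceTwo? (s , t) = ¬? (s ≟ₛ t) ×-dec ¬? (T? (adjacent s t)) ×-dec ¬? (all?ₗ ∅? (commonNeighbours s t))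

open Independence _≟ₛ_ segments segments-unique segments-complete AtDistanceTwo atDistanceTwo? blockingSet

selection : List Seg → Selection
selection U s = isYes (s ∈ₛ? U)

isMVSet⇒independent : ∀ {U} → IsMVSet U → Independent (selection U)
isMVSet⇒independent {U} mv (s , t) (s≢t , s≁t , nonEmpty) (s∈U ∷ t∈U ∷ commonNeighbours∈U) =
  let w₀ , w₀∈ , _ = find (¬All⇒Any¬ ∅? (commonNeighbours s t) nonEmpty)
      s~w₀ , w₀~t = ∈-commonNeighbours⁻ {s} {t} w₀∈
  in commonNeighbours⊆⇒¬mutuallyVisible {w₀ = w₀} (s≁t ∘ Adj⇒adjacent s t) s~w₀ w₀~t ⊆U
       (mv s t (toWitness s∈U) (toWitness t∈U) s≢t)
  where
  ⊆U : ∀ {w} → Adj s w → Adj w t → w ∈ U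
  ⊆U {w} s~w w~t = toWitness (All.lookup commonNeighbours∈U (∈-commonNeighbours⁺ {s} {t} {w} s~w w~t))

length≤size : ∀ {U} → Unique U → length U ≤ size (selection U)
length≤size {U} unique = unique-⊆⇒length≤ unique λ {s} s∈U →
  ∈-filter⁺ (T? ∘ selection U) (segments-complete s) (fromWitness s∈U)

VisibilityWitness : List Seg → Seg → Seg → Set
VisibilityWitness U s t = T (adjacent s t) ⊎ (¬ T (adjacent s t) × Any (_∉ U) (commonNeighbours s t))

visibilityWitness? : ∀ U s t → Dec (VisibilityWitness U s t)
visibilityWitness? U s t =
  T? (adjacent s t) ⊎-dec (¬? (T? (adjacent s t)) ×-dec any? (λ w → ¬? (w ∈ₛ? U)) (commonNeighbours s t))

witnessed⇒mutuallyVisible : ∀ {U} s t → VisibilityWitness U s t → MutuallyVisible U s t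
witnessed⇒mutuallyVisible s t (inj₁ s~t) = adjacent⇒mutuallyVisible (adjacent⇒Adj s t s~t)
witnessed⇒mutuallyVisible s t (inj₂ (s≁t , outside)) =
  let w , w∈ , w∉U = find outside
      s~w , w~t = ∈-commonNeighbours⁻ {s} {t} w∈
  in commonNeighbour⇒mutuallyVisible (s≁t ∘ Adj⇒adjacent s t) s~w w~t w∉U

witnessed⇒isMVSet : ∀ {U} → All (λ s → All (λ t → s ≢ t → VisibilityWitness U s t) U) U → IsMVSet U
witnessed⇒isMVSet witnessed s t s∈U t∈U s≢t =
  witnessed⇒mutuallyVisible s t (All.lookup (All.lookup witnessed s∈U) t∈U s≢t)

module _ where
  open import Agda.Builtin.FromNat using (fromNat)

  visibleSet : List Seg
  visibleSet =
    0 ─ 1 ∷ 0 ─ 2 ∷ 0 ─ 3 ∷ 0 ─ 4 ∷ 0 ─ 5 ∷ 0 ─ 6 ∷ 1 ─ 3 ∷ 1 ─ 5 ∷ 1 ─ 6 ∷ 2 ─ 3 ∷ 2 ─ 6 ∷ 3 ─ 4 ∷ []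

  blockingCertificate : Certificate
  blockingCertificate =
    branch (0 ─ 5)
      (branch (1 ─ 4)
         (branch (2 ─ 3)
            (packing ((0 ─ 6 , 1 ─ 4) ∷ (1 ─ 3 , 1 ─ 4) ∷ (1 ─ 4 , 1 ─ 6) ∷ (1 ─ 4 , 2 ─ 4) ∷
                      (1 ─ 4 , 4 ─ 6) ∷ (1 ─ 4 , 5 ─ 6) ∷ (0 ─ 2 , 1 ─ 4) ∷ (1 ─ 4 , 3 ─ 4) ∷
                      (0 ─ 3 , 0 ─ 4) ∷ []))
            (branch (1 ─ 2)
               (branch (3 ─ 6)
                  (conflict (1 ─ 2 , 1 ─ 4))
                  (branch (0 ─ 3)
                     (packing ((0 ─ 3 , 0 ─ 4) ∷ (0 ─ 3 , 0 ─ 5) ∷ (0 ─ 3 , 3 ─ 5) ∷ (1 ─ 3 , 1 ─ 4) ∷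
                               (1 ─ 4 , 2 ─ 4) ∷ (0 ─ 3 , 0 ─ 6) ∷ (0 ─ 3 , 3 ─ 4) ∷ []))
                     (branch (2 ─ 6)
                        (packing ((1 ─ 3 , 1 ─ 4) ∷ (1 ─ 4 , 2 ─ 4) ∷ (1 ─ 4 , 3 ─ 4) ∷ (1 ─ 4 , 3 ─ 5) ∷
                                  (0 ─ 4 , 2 ─ 5) ∷ (2 ─ 6 , 4 ─ 6) ∷ []))
                        (branch (1 ─ 3)
                           (conflict (1 ─ 3 , 1 ─ 4))
                           (branch (2 ─ 4)
                              (conflict (1 ─ 4 , 2 ─ 4))
                              (branch (2 ─ 5)
                                 (packing ((0 ─ 2 , 2 ─ 5) ∷ (0 ─ 4 , 2 ─ 5) ∷ (2 ─ 5 , 4 ─ 6) ∷ []))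
                                 (branch (0 ─ 2)
                                    (branch (3 ─ 5)
                                       (packing ((3 ─ 5 , 4 ─ 6) ∷ (0 ─ 2 , 0 ─ 6) ∷ []))
                                       (packing ((3 ─ 4 , 4 ─ 6) ∷ [])))
                                    (packing ((1 ─ 2 , 1 ─ 6) ∷ [])))))))))
               (branch (1 ─ 3)
                  (conflict (1 ─ 3 , 1 ─ 4))
                  (branch (2 ─ 4)
                     (conflict (1 ─ 4 , 2 ─ 4))
                     (branch (3 ─ 4)
                        (branch (2 ─ 6)
                           (conflict (1 ─ 4 , 3 ─ 4))
                           (branch (2 ─ 5)
                              (packing ((0 ─ 2 , 2 ─ 5) ∷ (0 ─ 5 , 2 ─ 5) ∷ (1 ─ 5 , 2 ─ 5) ∷
                                        (2 ─ 5 , 3 ─ 6) ∷ []))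
                              (branch (0 ─ 2)
                                 (packing ((0 ─ 2 , 1 ─ 4) ∷ (0 ─ 2 , 0 ─ 6) ∷ (0 ─ 3 , 1 ─ 5) ∷ []))
                                 (packing ((0 ─ 3 , 1 ─ 5) ∷ (1 ─ 6 , 3 ─ 6) ∷ [])))))
                        (packing ((0 ─ 2 , 1 ─ 4) ∷ (1 ─ 4 , 3 ─ 5) ∷ (0 ─ 3 , 1 ─ 5) ∷ (0 ─ 4 , 2 ─ 5) ∷
                                  [])))))))
         (branch (1 ─ 2)
            (branch (0 ─ 3)
               (branch (4 ─ 5)
                  (packing ((0 ─ 3 , 0 ─ 4) ∷ (0 ─ 3 , 0 ─ 5) ∷ (0 ─ 3 , 0 ─ 6) ∷ (0 ─ 3 , 1 ─ 6) ∷
                            (0 ─ 3 , 2 ─ 6) ∷ (0 ─ 3 , 3 ─ 5) ∷ (0 ─ 3 , 3 ─ 6) ∷ (0 ─ 3 , 2 ─ 4) ∷ []))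
                  (branch (4 ─ 6)
                     (conflict (0 ─ 3 , 0 ─ 5))
                     (branch (3 ─ 4)
                        (branch (5 ─ 6)
                           (conflict (0 ─ 3 , 3 ─ 4))
                           (branch (2 ─ 5)
                              (packing ((0 ─ 2 , 2 ─ 5) ∷ (0 ─ 3 , 0 ─ 4) ∷ (0 ─ 3 , 3 ─ 5) ∷
                                        (0 ─ 5 , 2 ─ 5) ∷ (1 ─ 2 , 2 ─ 5) ∷ []))
                              (packing ((0 ─ 3 , 0 ─ 4) ∷ (0 ─ 3 , 3 ─ 5) ∷ (0 ─ 5 , 0 ─ 6) ∷
                                        (3 ─ 4 , 3 ─ 6) ∷ []))))
                        (branch (3 ─ 5)
                           (conflict (0 ─ 3 , 3 ─ 5))
                           (branch (0 ─ 4)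
                              (conflict (0 ─ 3 , 0 ─ 4))
                              (branch (2 ─ 4)
                                 (packing ((0 ─ 3 , 2 ─ 4) ∷ (1 ─ 3 , 2 ─ 5) ∷ (2 ─ 4 , 2 ─ 6) ∷ []))
                                 (packing ((1 ─ 3 , 2 ─ 5) ∷ (3 ─ 6 , 5 ─ 6) ∷ []))))))))
               (branch (3 ─ 4)
                  (branch (2 ─ 5)
                     (branch (0 ─ 1)
                        (packing ((0 ─ 2 , 2 ─ 5) ∷ (0 ─ 5 , 2 ─ 5) ∷ (1 ─ 2 , 2 ─ 5) ∷ (1 ─ 5 , 2 ─ 5) ∷
                                  (2 ─ 5 , 2 ─ 6) ∷ (2 ─ 5 , 3 ─ 6) ∷ (2 ─ 5 , 4 ─ 6) ∷ []))
                        (branch (0 ─ 6)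
                           (conflict (1 ─ 2 , 2 ─ 5))
                           (branch (1 ─ 6)
                              (conflict (0 ─ 5 , 2 ─ 5))
                              (branch (0 ─ 2)
                                 (conflict (0 ─ 2 , 2 ─ 5))
                                 (branch (1 ─ 5)
                                    (conflict (1 ─ 5 , 2 ─ 5))
                                    (branch (0 ─ 4)
                                       (packing ((0 ─ 4 , 4 ─ 6) ∷ (1 ─ 2 , 2 ─ 6) ∷ []))
                                       (packing ((0 ─ 5 , 5 ─ 6) ∷ []))))))))
                     (branch (0 ─ 6)
                        (branch (1 ─ 3)
                           (branch (5 ─ 6)
                              (conflict (1 ─ 3 , 3 ─ 4))
                              (branch (3 ─ 5)
                                 (conflict (1 ─ 3 , 3 ─ 5))
                                 (branch (2 ─ 3)
                                    (packing ((0 ─ 4 , 0 ─ 6) ∷ (0 ─ 5 , 0 ─ 6) ∷ (0 ─ 6 , 4 ─ 6) ∷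
                                              (0 ─ 6 , 3 ─ 6) ∷ []))
                                    (packing ((0 ─ 6 , 3 ─ 6) ∷ (1 ─ 3 , 1 ─ 5) ∷ (0 ─ 4 , 2 ─ 4) ∷ [])))))
                           (branch (1 ─ 6)
                              (branch (3 ─ 5)
                                 (branch (2 ─ 6)
                                    (conflict (0 ─ 5 , 3 ─ 5))
                                    (branch (2 ─ 4)
                                       (packing ((0 ─ 4 , 2 ─ 4) ∷ (1 ─ 2 , 2 ─ 4) ∷ (2 ─ 4 , 3 ─ 5) ∷
                                                 (0 ─ 2 , 0 ─ 6) ∷ []))
                                       (branch (0 ─ 2)
                                          (packing ((0 ─ 2 , 0 ─ 6) ∷ (0 ─ 2 , 0 ─ 4) ∷ (1 ─ 6 , 4 ─ 6) ∷ []))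
                                          (packing ((0 ─ 6 , 3 ─ 6) ∷ (1 ─ 6 , 4 ─ 6) ∷ [])))))
                                 (packing ((0 ─ 4 , 2 ─ 4) ∷ (0 ─ 6 , 3 ─ 6) ∷ (1 ─ 6 , 4 ─ 6) ∷
                                           (2 ─ 6 , 5 ─ 6) ∷ [])))
                              (branch (3 ─ 6)
                                 (packing ((0 ─ 6 , 3 ─ 6) ∷ (0 ─ 2 , 0 ─ 4) ∷ (1 ─ 2 , 1 ─ 5) ∷
                                           (1 ─ 2 , 2 ─ 4) ∷ []))
                                 (packing ((1 ─ 2 , 2 ─ 4) ∷ (0 ─ 2 , 0 ─ 6) ∷ (2 ─ 6 , 4 ─ 6) ∷ [])))))
                        (branch (2 ─ 6)
                           (branch (0 ─ 4)
                              (packing ((0 ─ 4 , 3 ─ 4) ∷ (0 ─ 2 , 0 ─ 4) ∷ (1 ─ 2 , 2 ─ 6) ∷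
                                        (2 ─ 6 , 5 ─ 6) ∷ (0 ─ 4 , 4 ─ 6) ∷ []))
                              (branch (1 ─ 5)
                                 (branch (4 ─ 6)
                                    (packing ((1 ─ 2 , 1 ─ 5) ∷ (1 ─ 3 , 1 ─ 5) ∷ (1 ─ 5 , 3 ─ 5) ∷
                                              (2 ─ 6 , 4 ─ 6) ∷ []))
                                    (packing ((1 ─ 5 , 3 ─ 5) ∷ (2 ─ 4 , 2 ─ 6) ∷ (1 ─ 5 , 4 ─ 5) ∷ [])))
                                 (packing ((0 ─ 5 , 3 ─ 5) ∷ (2 ─ 6 , 5 ─ 6) ∷ (0 ─ 2 , 0 ─ 5) ∷ []))))
                           (branch (0 ─ 2)
                              (packing ((0 ─ 2 , 0 ─ 4) ∷ (0 ─ 2 , 2 ─ 4) ∷ (0 ─ 2 , 1 ─ 6) ∷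
                                        (1 ─ 3 , 1 ─ 5) ∷ []))
                              (branch (1 ─ 6)
                                 (branch (0 ─ 4)
                                    (packing ((0 ─ 4 , 2 ─ 4) ∷ (1 ─ 2 , 1 ─ 6) ∷ (1 ─ 6 , 4 ─ 6) ∷ []))
                                    (packing ((1 ─ 6 , 4 ─ 6) ∷ (2 ─ 4 , 3 ─ 6) ∷ [])))
                                 (packing ((1 ─ 2 , 1 ─ 5) ∷ (0 ─ 4 , 5 ─ 6) ∷ [])))))))
                  (branch (0 ─ 1)
                     (branch (3 ─ 6)
                        (branch (0 ─ 4)
                           (packing ((0 ─ 2 , 0 ─ 4) ∷ (2 ─ 5 , 3 ─ 6) ∷ (0 ─ 1 , 0 ─ 4) ∷ (0 ─ 4 , 2 ─ 4) ∷
                                     (0 ─ 6 , 3 ─ 6) ∷ (1 ─ 3 , 1 ─ 5) ∷ []))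
                           (packing ((2 ─ 5 , 3 ─ 6) ∷ (0 ─ 6 , 3 ─ 6) ∷ (2 ─ 4 , 3 ─ 6) ∷ (3 ─ 5 , 3 ─ 6) ∷
                                     (1 ─ 6 , 4 ─ 6) ∷ [])))
                        (branch (4 ─ 6)
                           (packing ((2 ─ 5 , 4 ─ 6) ∷ (1 ─ 3 , 1 ─ 5) ∷ (1 ─ 6 , 4 ─ 6) ∷ (3 ─ 5 , 4 ─ 6) ∷
                                     (1 ─ 2 , 2 ─ 4) ∷ []))
                           (branch (0 ─ 6)
                              (branch (1 ─ 6)
                                 (branch (2 ─ 4)
                                    (packing ((0 ─ 4 , 2 ─ 4) ∷ (1 ─ 2 , 2 ─ 4) ∷ (2 ─ 4 , 2 ─ 5) ∷
                                              (2 ─ 4 , 3 ─ 5) ∷ []))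
                                    (branch (3 ─ 5)
                                       (packing ((0 ─ 5 , 3 ─ 5) ∷ (1 ─ 3 , 3 ─ 5) ∷ (2 ─ 3 , 3 ─ 5) ∷ []))
                                       (branch (2 ─ 5)
                                          (packing ((0 ─ 4 , 2 ─ 5) ∷ (1 ─ 3 , 2 ─ 5) ∷ []))
                                          (packing ((0 ─ 4 , 0 ─ 6) ∷ [])))))
                                 (packing ((1 ─ 2 , 2 ─ 4) ∷ (1 ─ 3 , 2 ─ 5) ∷ (1 ─ 5 , 3 ─ 5) ∷ [])))
                              (packing ((0 ─ 2 , 2 ─ 4) ∷ (0 ─ 4 , 2 ─ 5) ∷ (1 ─ 5 , 3 ─ 5) ∷ [])))))
                     (branch (0 ─ 4)
                        (branch (1 ─ 3)
                           (packing ((0 ─ 2 , 0 ─ 4) ∷ (0 ─ 4 , 0 ─ 6) ∷ (0 ─ 4 , 2 ─ 4) ∷ (1 ─ 3 , 1 ─ 5) ∷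
                                     (1 ─ 3 , 2 ─ 6) ∷ []))
                           (packing ((0 ─ 2 , 0 ─ 4) ∷ (0 ─ 4 , 2 ─ 4) ∷ (1 ─ 5 , 3 ─ 5) ∷ (1 ─ 2 , 2 ─ 3) ∷
                                     [])))
                        (packing ((0 ─ 2 , 2 ─ 4) ∷ (0 ─ 5 , 3 ─ 5) ∷ (0 ─ 6 , 3 ─ 6) ∷ (1 ─ 3 , 1 ─ 5) ∷
                                  []))))))
            (branch (2 ─ 5)
               (branch (0 ─ 1)
                  (packing ((2 ─ 5 , 3 ─ 6) ∷ (2 ─ 5 , 4 ─ 6) ∷ (0 ─ 2 , 2 ─ 5) ∷ (0 ─ 4 , 2 ─ 5) ∷
                            (1 ─ 3 , 2 ─ 5) ∷ (0 ─ 3 , 2 ─ 4) ∷ (1 ─ 5 , 3 ─ 5) ∷ []))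
                  (branch (3 ─ 4)
                     (branch (1 ─ 6)
                        (conflict (0 ─ 5 , 2 ─ 5))
                        (branch (0 ─ 2)
                           (conflict (0 ─ 2 , 2 ─ 5))
                           (branch (1 ─ 5)
                              (conflict (1 ─ 5 , 2 ─ 5))
                              (branch (1 ─ 3)
                                 (packing ((1 ─ 3 , 2 ─ 5) ∷ (0 ─ 3 , 2 ─ 4) ∷ (1 ─ 3 , 2 ─ 6) ∷ []))
                                 (packing ((0 ─ 3 , 2 ─ 4) ∷ (0 ─ 6 , 2 ─ 6) ∷ []))))))
                     (branch (1 ─ 3)
                        (packing ((1 ─ 3 , 2 ─ 5) ∷ (0 ─ 4 , 2 ─ 5) ∷ (1 ─ 3 , 1 ─ 5) ∷ (0 ─ 2 , 2 ─ 4) ∷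
                                  (0 ─ 3 , 2 ─ 6) ∷ []))
                        (branch (1 ─ 6)
                           (packing ((0 ─ 4 , 2 ─ 5) ∷ (0 ─ 3 , 1 ─ 6) ∷ (1 ─ 6 , 4 ─ 6) ∷ (0 ─ 2 , 2 ─ 4) ∷
                                     []))
                           (branch (0 ─ 3)
                              (packing ((0 ─ 3 , 1 ─ 5) ∷ (0 ─ 3 , 2 ─ 4) ∷ (0 ─ 3 , 2 ─ 6) ∷ []))
                              (packing ((0 ─ 2 , 0 ─ 4) ∷ (1 ─ 5 , 3 ─ 5) ∷ [])))))))
               (branch (4 ─ 5)
                  (branch (4 ─ 6)
                     (branch (5 ─ 6)
                        (branch (0 ─ 3)
                           (packing ((0 ─ 1 , 0 ─ 3) ∷ (0 ─ 2 , 0 ─ 3) ∷ (0 ─ 3 , 1 ─ 3) ∷ (0 ─ 3 , 1 ─ 5) ∷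
                                     (0 ─ 3 , 1 ─ 6) ∷ (0 ─ 3 , 2 ─ 3) ∷ []))
                           (branch (1 ─ 3)
                              (packing ((0 ─ 1 , 1 ─ 3) ∷ (0 ─ 2 , 1 ─ 3) ∷ (1 ─ 3 , 1 ─ 5) ∷
                                        (1 ─ 3 , 1 ─ 6) ∷ (1 ─ 3 , 2 ─ 4) ∷ []))
                              (branch (0 ─ 2)
                                 (packing ((0 ─ 2 , 2 ─ 3) ∷ (0 ─ 2 , 2 ─ 4) ∷ (0 ─ 2 , 0 ─ 4) ∷
                                           (0 ─ 2 , 0 ─ 6) ∷ []))
                                 (branch (1 ─ 6)
                                    (packing ((1 ─ 6 , 4 ─ 6) ∷ (0 ─ 4 , 2 ─ 4) ∷ (1 ─ 5 , 3 ─ 5) ∷ []))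
                                    (branch (1 ─ 5)
                                       (packing ((1 ─ 5 , 3 ─ 5) ∷ (2 ─ 4 , 4 ─ 6) ∷ []))
                                       (packing ((2 ─ 6 , 5 ─ 6) ∷ [])))))))
                        (branch (1 ─ 5)
                           (packing ((0 ─ 3 , 1 ─ 5) ∷ (1 ─ 3 , 1 ─ 5) ∷ (1 ─ 5 , 3 ─ 5) ∷ (1 ─ 6 , 4 ─ 6) ∷
                                     (2 ─ 4 , 4 ─ 6) ∷ []))
                           (branch (1 ─ 6)
                              (packing ((0 ─ 3 , 1 ─ 6) ∷ (1 ─ 6 , 4 ─ 6) ∷ (0 ─ 4 , 2 ─ 4) ∷
                                        (0 ─ 2 , 0 ─ 5) ∷ []))
                              (packing ((0 ─ 3 , 2 ─ 6) ∷ (0 ─ 2 , 0 ─ 4) ∷ (1 ─ 3 , 3 ─ 5) ∷ [])))))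
                     (branch (1 ─ 6)
                        (branch (0 ─ 4)
                           (packing ((0 ─ 3 , 1 ─ 6) ∷ (0 ─ 4 , 2 ─ 4) ∷ (1 ─ 3 , 1 ─ 6) ∷ (1 ─ 6 , 3 ─ 6) ∷
                                     (0 ─ 2 , 1 ─ 6) ∷ []))
                           (packing ((0 ─ 3 , 1 ─ 6) ∷ (0 ─ 2 , 1 ─ 6) ∷ (2 ─ 4 , 4 ─ 5) ∷ (1 ─ 5 , 4 ─ 5) ∷
                                     [])))
                        (packing ((0 ─ 3 , 2 ─ 6) ∷ (0 ─ 2 , 0 ─ 4) ∷ (1 ─ 3 , 3 ─ 5) ∷ (1 ─ 5 , 5 ─ 6) ∷
                                  []))))
                  (branch (1 ─ 5)
                     (branch (2 ─ 4)
                        (packing ((0 ─ 2 , 2 ─ 4) ∷ (0 ─ 3 , 1 ─ 5) ∷ (0 ─ 4 , 2 ─ 4) ∷ (1 ─ 5 , 3 ─ 5) ∷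
                                  (2 ─ 4 , 3 ─ 6) ∷ []))
                        (packing ((0 ─ 3 , 1 ─ 5) ∷ (1 ─ 5 , 3 ─ 5) ∷ (0 ─ 2 , 0 ─ 4) ∷ (1 ─ 3 , 3 ─ 4) ∷
                                  [])))
                     (packing ((0 ─ 2 , 0 ─ 4) ∷ (0 ─ 3 , 2 ─ 4) ∷ (1 ─ 3 , 3 ─ 5) ∷ (1 ─ 6 , 4 ─ 6) ∷
                               [])))))))
      (branch (0 ─ 3)
         (branch (4 ─ 5)
            (branch (1 ─ 2)
               (packing ((0 ─ 3 , 0 ─ 4) ∷ (0 ─ 3 , 0 ─ 6) ∷ (0 ─ 3 , 1 ─ 6) ∷ (0 ─ 3 , 2 ─ 6) ∷
                         (0 ─ 3 , 3 ─ 5) ∷ (0 ─ 3 , 3 ─ 6) ∷ (0 ─ 3 , 1 ─ 5) ∷ (0 ─ 3 , 2 ─ 4) ∷ []))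
               (branch (5 ─ 6)
                  (packing ((0 ─ 3 , 1 ─ 6) ∷ (0 ─ 3 , 2 ─ 4) ∷ (0 ─ 3 , 2 ─ 6) ∷ (0 ─ 1 , 0 ─ 3) ∷
                            (1 ─ 4 , 5 ─ 6) ∷ (0 ─ 2 , 0 ─ 4) ∷ (1 ─ 3 , 2 ─ 5) ∷ []))
                  (branch (2 ─ 6)
                     (conflict (0 ─ 3 , 2 ─ 6))
                     (branch (1 ─ 6)
                        (conflict (0 ─ 3 , 1 ─ 6))
                        (branch (2 ─ 5)
                           (packing ((0 ─ 2 , 2 ─ 5) ∷ (0 ─ 3 , 1 ─ 5) ∷ (1 ─ 3 , 2 ─ 5) ∷ (2 ─ 5 , 3 ─ 6) ∷
                                     []))
                           (packing ((0 ─ 3 , 1 ─ 5) ∷ (0 ─ 2 , 0 ─ 4) ∷ (0 ─ 6 , 1 ─ 4) ∷ [])))))))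
            (branch (1 ─ 2)
               (branch (0 ─ 4)
                  (conflict (0 ─ 3 , 0 ─ 4))
                  (branch (3 ─ 5)
                     (conflict (0 ─ 3 , 3 ─ 5))
                     (branch (3 ─ 4)
                        (branch (5 ─ 6)
                           (conflict (0 ─ 3 , 3 ─ 4))
                           (branch (2 ─ 5)
                              (packing ((0 ─ 2 , 2 ─ 5) ∷ (1 ─ 2 , 2 ─ 5) ∷ (1 ─ 5 , 2 ─ 5) ∷
                                        (2 ─ 5 , 2 ─ 6) ∷ []))
                              (branch (1 ─ 5)
                                 (packing ((0 ─ 3 , 1 ─ 5) ∷ (0 ─ 2 , 1 ─ 4) ∷ (0 ─ 6 , 1 ─ 5) ∷ []))
                                 (packing ((0 ─ 2 , 1 ─ 4) ∷ (0 ─ 6 , 4 ─ 6) ∷ [])))))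
                        (packing ((0 ─ 3 , 1 ─ 5) ∷ (0 ─ 3 , 2 ─ 4) ∷ (0 ─ 2 , 1 ─ 4) ∷ (1 ─ 3 , 2 ─ 5) ∷
                                  [])))))
               (branch (2 ─ 5)
                  (packing ((0 ─ 2 , 2 ─ 5) ∷ (0 ─ 3 , 1 ─ 5) ∷ (0 ─ 3 , 2 ─ 4) ∷ (0 ─ 4 , 2 ─ 5) ∷
                            (1 ─ 3 , 2 ─ 5) ∷ (2 ─ 5 , 3 ─ 6) ∷ []))
                  (branch (1 ─ 5)
                     (packing ((0 ─ 3 , 1 ─ 5) ∷ (0 ─ 3 , 2 ─ 4) ∷ (1 ─ 5 , 3 ─ 5) ∷ (0 ─ 2 , 0 ─ 4) ∷
                               (0 ─ 6 , 1 ─ 4) ∷ []))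
                     (branch (5 ─ 6)
                        (packing ((0 ─ 3 , 2 ─ 4) ∷ (1 ─ 4 , 5 ─ 6) ∷ (0 ─ 2 , 0 ─ 4) ∷ (1 ─ 3 , 3 ─ 5) ∷ []))
                        (branch (1 ─ 4)
                           (packing ((0 ─ 2 , 1 ─ 4) ∷ (0 ─ 6 , 1 ─ 4) ∷ (1 ─ 4 , 3 ─ 5) ∷ []))
                           (packing ((0 ─ 2 , 0 ─ 4) ∷ (1 ─ 3 , 3 ─ 5) ∷ []))))))))
         (branch (2 ─ 5)
            (branch (0 ─ 1)
               (branch (3 ─ 4)
                  (packing ((0 ─ 2 , 2 ─ 5) ∷ (1 ─ 5 , 2 ─ 5) ∷ (2 ─ 5 , 2 ─ 6) ∷ (2 ─ 5 , 3 ─ 6) ∷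
                            (2 ─ 5 , 4 ─ 6) ∷ (2 ─ 5 , 5 ─ 6) ∷ (0 ─ 4 , 2 ─ 5) ∷ []))
                  (packing ((2 ─ 5 , 3 ─ 6) ∷ (2 ─ 5 , 4 ─ 6) ∷ (0 ─ 4 , 2 ─ 5) ∷ (1 ─ 3 , 2 ─ 5) ∷
                            (0 ─ 2 , 2 ─ 4) ∷ (1 ─ 4 , 3 ─ 5) ∷ [])))
               (branch (3 ─ 4)
                  (branch (0 ─ 2)
                     (conflict (0 ─ 2 , 2 ─ 5))
                     (branch (1 ─ 5)
                        (conflict (1 ─ 5 , 2 ─ 5))
                        (branch (0 ─ 6)
                           (packing ((1 ─ 2 , 2 ─ 5) ∷ (1 ─ 3 , 2 ─ 5) ∷ (0 ─ 4 , 2 ─ 5) ∷ (0 ─ 6 , 1 ─ 4) ∷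
                                     []))
                           (branch (0 ─ 4)
                              (packing ((0 ─ 4 , 2 ─ 5) ∷ (1 ─ 4 , 3 ─ 5) ∷ (0 ─ 4 , 4 ─ 6) ∷ []))
                              (packing ((1 ─ 4 , 3 ─ 5) ∷ (1 ─ 6 , 5 ─ 6) ∷ []))))))
                  (branch (0 ─ 4)
                     (branch (1 ─ 6)
                        (conflict (0 ─ 4 , 2 ─ 5))
                        (branch (1 ─ 3)
                           (packing ((1 ─ 3 , 2 ─ 5) ∷ (0 ─ 2 , 0 ─ 4) ∷ (1 ─ 3 , 1 ─ 5) ∷ (0 ─ 4 , 5 ─ 6) ∷
                                     []))
                           (packing ((0 ─ 2 , 0 ─ 4) ∷ (0 ─ 6 , 1 ─ 4) ∷ (1 ─ 5 , 3 ─ 5) ∷ []))))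
                     (branch (0 ─ 6)
                        (packing ((1 ─ 3 , 2 ─ 5) ∷ (0 ─ 6 , 1 ─ 4) ∷ (0 ─ 2 , 2 ─ 4) ∷ (0 ─ 6 , 3 ─ 6) ∷ []))
                        (branch (1 ─ 4)
                           (packing ((0 ─ 2 , 1 ─ 4) ∷ (1 ─ 4 , 3 ─ 5) ∷ (1 ─ 4 , 5 ─ 6) ∷ []))
                           (packing ((0 ─ 2 , 2 ─ 4) ∷ (1 ─ 3 , 1 ─ 5) ∷ [])))))))
            (branch (2 ─ 3)
               (branch (1 ─ 4)
                  (packing ((0 ─ 6 , 1 ─ 4) ∷ (1 ─ 4 , 5 ─ 6) ∷ (0 ─ 2 , 1 ─ 4) ∷ (1 ─ 4 , 3 ─ 5) ∷
                            (0 ─ 4 , 2 ─ 4) ∷ (1 ─ 3 , 1 ─ 5) ∷ []))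
                  (branch (0 ─ 4)
                     (branch (1 ─ 2)
                        (branch (1 ─ 3)
                           (packing ((0 ─ 4 , 0 ─ 6) ∷ (0 ─ 4 , 4 ─ 6) ∷ (0 ─ 4 , 5 ─ 6) ∷ (0 ─ 2 , 0 ─ 4) ∷
                                     (0 ─ 4 , 2 ─ 4) ∷ []))
                           (branch (3 ─ 6)
                              (packing ((0 ─ 2 , 0 ─ 4) ∷ (0 ─ 1 , 0 ─ 4) ∷ (0 ─ 4 , 2 ─ 4) ∷
                                        (0 ─ 6 , 3 ─ 6) ∷ []))
                              (packing ((0 ─ 4 , 2 ─ 4) ∷ (1 ─ 5 , 3 ─ 5) ∷ (0 ─ 2 , 2 ─ 3) ∷ []))))
                        (packing ((0 ─ 2 , 0 ─ 4) ∷ (0 ─ 4 , 2 ─ 4) ∷ (1 ─ 3 , 1 ─ 5) ∷ (2 ─ 6 , 5 ─ 6) ∷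
                                  [])))
                     (branch (3 ─ 5)
                        (branch (0 ─ 6)
                           (packing ((1 ─ 3 , 3 ─ 5) ∷ (1 ─ 5 , 3 ─ 5) ∷ (2 ─ 3 , 3 ─ 5) ∷ (0 ─ 2 , 0 ─ 6) ∷
                                     []))
                           (branch (1 ─ 5)
                              (packing ((1 ─ 5 , 3 ─ 5) ∷ (1 ─ 3 , 1 ─ 5) ∷ (0 ─ 2 , 2 ─ 4) ∷ []))
                              (branch (0 ─ 2)
                                 (packing ((0 ─ 2 , 2 ─ 4) ∷ (0 ─ 2 , 1 ─ 6) ∷ []))
                                 (packing ((1 ─ 6 , 5 ─ 6) ∷ [])))))
                        (packing ((0 ─ 2 , 2 ─ 4) ∷ (1 ─ 3 , 1 ─ 5) ∷ (0 ─ 6 , 3 ─ 6) ∷ [])))))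
               (branch (0 ─ 2)
                  (branch (3 ─ 5)
                     (packing ((0 ─ 2 , 0 ─ 4) ∷ (0 ─ 2 , 2 ─ 4) ∷ (1 ─ 3 , 3 ─ 5) ∷ (1 ─ 4 , 3 ─ 5) ∷
                               (0 ─ 2 , 1 ─ 6) ∷ []))
                     (packing ((0 ─ 2 , 0 ─ 4) ∷ (0 ─ 2 , 2 ─ 4) ∷ (1 ─ 3 , 1 ─ 5) ∷ (3 ─ 4 , 4 ─ 5) ∷ [])))
                  (packing ((0 ─ 4 , 2 ─ 4) ∷ (1 ─ 3 , 1 ─ 5) ∷ (1 ─ 4 , 3 ─ 5) ∷ (0 ─ 6 , 3 ─ 6) ∷ []))))))

visibleSet-isMVSet : IsMVSet visibleSet
visibleSet-isMVSet = witnessed⇒isMVSet (from-yes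
  (all?ₗ (λ s → all?ₗ (λ t → ¬? (s ≟ₛ t) →-dec visibilityWitness? visibleSet s t) visibleSet) visibleSet))

isMVSet⇒length≤12 : ∀ U → Unique U → IsMVSet U → length U ≤ 12
isMVSet⇒length≤12 U unique mv = ℕ.≤-trans (length≤size unique)
  (valid⇒size≤ (isMVSet⇒independent mv) blockingCertificate
    (from-yes (valid? 12 [] [] blockingCertificate)) ([] , []))

generalPosition : GeneralPosition P
generalPosition = distinct , λ i j k i≢j i≢k j≢k → offLine⇒¬collinear {P i} {P j} (offLine i j k i≢j i≢k j≢k)
  where
  distinct : ∀ i j → i ≢ j → P i ≢ P j
  distinct = from-yes (all? λ i → all? λ j → ¬? (i ≟ᶠ j) →-dec ¬? (P i ≟ᵖ P j))
  offLine : ∀ i j k → i ≢ j → i ≢ k → j ≢ k → OffLine (P i) (P j) (P k)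
  offLine = from-yes (all? λ i → all? λ j → all? λ k →
    ¬? (i ≟ᶠ j) →-dec ¬? (i ≟ᶠ k) →-dec ¬? (j ≟ᶠ k) →-dec offLine? (P i) (P j) (P k))

proposition1 : GeneralPosition P × MuEq 12 × (7 C 2) ∸ 9 ≡ 12
proposition1 =
  generalPosition ,
  ((visibleSet , from-yes (unique? visibleSet) , visibleSet-isMVSet , refl) , isMVSet⇒length≤12) ,
  refl
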